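{- Let $\gamma:\mathcal{L}\to\mathcal{L}$ be total, $s$ a store and $h:\mathcal{L}\rightharpoonup\mathcal{L}^\kappa$, $h':\mathcal{L}\rightharpoonup\mathcal{L}^{\kappa+\nu+\mu}$ heaps. If $(s,h')\triangleright_\gamma(s,h)$ then $h=\gamma(\mathrm{trunc}(h'))$, and consequently $(s,h')\triangleright_{\mathrm{id}}(s,\mathrm{trunc}(h'))$.
   Context: Fix natural numbers $\kappa$, $\mu$, and $\nu>0$, and a vector $\mathbf{w}=(w_1,\dots,w_\nu)$ of variables. Locations form a countably infinite set $\mathcal{L}$ containing a special $\underline{\bot}$; stores $s$ are partial maps from variables and a constant $\bot$ to $\mathcal{L}$ with $s(x)=\underline{\bot}$ iff $x=\bot$, and all stores considered have $\{w_1,\dots,w_\nu,\bot\}\subseteq\mathrm{dom}(s)$. Heaps are finite partial maps from $\mathcal{L}$ to tuples of locations, never allocating $\underline{\bot}$. Write $\underline{\boldsymbol{\bot}}$ for the tuple $(\underline{\bot},\dots,\underline{\bot})$ of length $\kappa+\nu+\mu$. For $\gamma:\mathcal{L}\to\mathcal{L}$ apply $\gamma$ componentwise to tuples; $\gamma(h)$ (defined when $\gamma$ is injective on $\mathrm{dom}(h)$) has domain $\gamma(\mathrm{dom}(h))$ and $\gamma(h)(\gamma(\ell))=\gamma(h(\ell))$. Expansion: $(s,h')\triangleright_\gamma(s,h)$, for $h:\mathcal{L}\rightharpoonup\mathcal{L}^\kappa$ and $h':\mathcal{L}\rightharpoonup\mathcal{L}^{\kappa+\nu+\mu}$, iff there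 are disjoint heaps $\mathrm{main}(h')$, $\mathrm{aux}(h')$ with $h'=\mathrm{main}(h')\uplus\mathrm{aux}(h')$ such that: (1) $\gamma$ is injective on $\mathrm{dom}(\mathrm{main}(h'))$; (2) $\gamma(\mathrm{dom}(\mathrm{main}(h')))=\mathrm{dom}(h)$; (3) for each $\ell\in\mathrm{dom}(\mathrm{main}(h'))$, $h'(\ell)=(\mathbf{a},s(\mathbf{w}),b_1,\dots,b_\mu)$ for some $\mathbf{a}\in\mathcal{L}^\kappa$, $b_i\in\mathcal{L}$, with $\gamma(\mathbf{a})=h(\gamma(\ell))$; (4) for each $\ell\in\mathrm{dom}(\mathrm{aux}(h'))$, $h'(\ell)=\underline{\boldsymbol{\bot}}$ and there is $\ell'\in\mathrm{dom}(\mathrm{main}(h'))$ with $\mathrm{main}(h')(\ell')=(\mathbf{a},\mathbf{l},b_1,\dots,b_\mu)$ ($\mathbf{l}$ a $\nu$-tuple) and $\ell=b_i$ for some $i$ (such $\ell'$ is a connection of $\ell$ in $h'$). Truncation: $\mathrm{trunc}(h')$ has domain $\mathrm{dom}(h')\setminus\{\ell\mid h'(\ell)=\underline{\boldsymbol{\bot}}\}$ and maps $\ell$ to the first $\kappa$ components of $h'(\ell)$. -}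

module Defs where

open import Data.Nat using (ℕ; zero; suc; _+_; _≤_; _<_)
open import Data.Maybe using (Maybe; just; nothing)
import Data.Maybe as Maybe
open import Data.Vec using (Vec; _++_; map; replicate; take)
open import Data.Vec.Properties using (≡-dec)
open import Data.Vec.Membership.Propositional using (_∈_)
open import Data.Vec.Relation.Unary.All using (All)
open import Data.Vec.Relation.Binary.Pointwise.Inductive using (Pointwise)
open import Data.Product using (Σ; ∃; ∃-syntax; _×_; _,_)
open import Data.Sum using (_⊎_)
open import Relation.Nullary using (¬_; yes; no)
open import Relation.Binary.PropositionalEquality using (_≡_; _≢_)
import Data.Nat as N

Loc : Set
Loc = ℕ

⊥L : Loc
⊥L = 0

Var : Set
Var = ℕ

PMap : ℕ → Set
PMap n = Loc → Maybe (Vec Loc n)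

InDom : ∀ {n} → PMap n → Loc → Set
InDom h ℓ = ∃[ v ] (h ℓ ≡ just v)

record IsHeap {n : ℕ} (h : PMap n) : Set where
  field
    finite  : ∃[ N ] (∀ ℓ → N ≤ ℓ → h ℓ ≡ nothing)
    no-⊥    : h ⊥L ≡ nothing

-- Stores, w.r.t. the fixed variable vector w. The constant ⊥ is implicitly
-- mapped to ⊥̲; ordinary variables are never mapped to ⊥̲; w ⊆ dom(s).
record Store {ν : ℕ} (w : Vec Var ν) : Set where
  field
    val     : Var → Maybe Loc
    val-≢⊥  : ∀ x ℓ → val x ≡ just ℓ → ℓ ≢ ⊥L
    w-dom   : All (λ x → ∃[ ℓ ] (val x ≡ just ℓ)) w

StoreOf : ∀ {ν} {w : Vec Var ν} → Store w → Vec Loc ν → Set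
StoreOf {w = w} s l = Pointwise (λ x ℓ → Store.val s x ≡ just ℓ) w l

-- Image γ(g) of a partial map:  Image γ g f  means "γ(g) is defined and f = γ(g)".
record Image {n : ℕ} (γ : Loc → Loc) (g f : PMap n) : Set where
  field
    inj     : ∀ ℓ₁ ℓ₂ → InDom g ℓ₁ → InDom g ℓ₂ → γ ℓ₁ ≡ γ ℓ₂ → ℓ₁ ≡ ℓ₂
    onDom   : ∀ ℓ → InDom g ℓ → f (γ ℓ) ≡ Maybe.map (map γ) (g ℓ)
    dom⊆    : ∀ ℓ' → InDom f ℓ' → ∃[ ℓ ] (InDom g ℓ × γ ℓ ≡ ℓ')

trunc : ∀ κ ν μ → PMap (κ + ν + μ) → PMap κ
trunc κ ν μ h' ℓ with h' ℓ
... | nothing = nothing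
... | just v with ≡-dec N._≟_ v (replicate (κ + ν + μ) ⊥L)
...   | yes _ = nothing
...   | no _  = just (take κ (take (κ + ν) v))

record Expansion (κ ν μ : ℕ) (w : Vec Var ν) (s : Store w) (γ : Loc → Loc)
                 (h' : PMap (κ + ν + μ)) (h : PMap κ) : Set where
  field
    main aux    : PMap (κ + ν + μ)
    main-heap   : IsHeap main
    aux-heap    : IsHeap aux
    disjoint    : ∀ ℓ → main ℓ ≡ nothing ⊎ aux ℓ ≡ nothing
    union       : ∀ ℓ → h' ℓ ≡ Maybe._<∣>_ (main ℓ) (aux ℓ)
    inj         : ∀ ℓ₁ ℓ₂ → InDom main ℓ₁ → InDom main ℓ₂ → γ ℓ₁ ≡ γ ℓ₂ → ℓ₁ ≡ ℓ₂
    dom-to      : ∀ ℓ → InDom main ℓ → InDom h (γ ℓ)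
    dom-from    : ∀ ℓ' → InDom h ℓ' → ∃[ ℓ ] (InDom main ℓ × γ ℓ ≡ ℓ')
    -- (3)
    main-shape  : ∀ ℓ v → main ℓ ≡ just v →
                  Σ (Vec Loc κ) λ a → Σ (Vec Loc ν) λ l → Σ (Vec Loc μ) λ b → (v ≡ (a ++ l) ++ b × StoreOf s l
                                        × h (γ ℓ) ≡ just (map γ a))
    aux-shape   : ∀ ℓ v → aux ℓ ≡ just v →
                  v ≡ replicate (κ + ν + μ) ⊥L
                  × Σ Loc λ ℓ' → Σ (Vec Loc κ) λ a → Σ (Vec Loc ν) λ l →
                    Σ (Vec Loc μ) λ b →
                      (main ℓ' ≡ just ((a ++ l) ++ b) × ℓ ∈ b)

-- The store part s(w) of a main cell is a nonempty (ν > 0) tuple of locations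
-- different from ⊥̲, so no main cell is the all-⊥̲ tuple, while every auxiliary
-- cell is.  Hence truncation deletes exactly the auxiliary cells and cuts every
-- main cell down to its first κ components: trunc(h') is main(h') with its cells
-- truncated.  Condition (3) then says that γ maps trunc(h') onto h, and with
-- γ = id the same decomposition of h' witnesses (s,h') ▷_id (s,trunc(h')).
module Submission where

open import Defs
open import Data.Nat using (ℕ; _<_; _+_; suc; s≤s; z≤n)
import Data.Nat as ℕ
open import Data.Vec using (Vec; []; _∷_; _++_; take; replicate; map)
open import Data.Vec.Properties using (≡-dec; map-id)
open import Data.Vec.Membership.Propositional using (_∈_)
open import Data.Vec.Membership.Propositional.Properties using (∈-++⁺ˡ; ∈-++⁺ʳ)
open import Data.Vec.Relation.Unary.Any using (here; there)
open import Data.Vec.Relation.Binary.Pointwise.Inductive using (_∷_)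
open import Data.Maybe using (just; nothing)
import Data.Maybe as Maybe
open import Data.Maybe.Properties using (map-just)
open import Data.Product using (_×_; _,_; ∃-syntax)
open import Relation.Nullary using (yes; no; contradiction)
open import Relation.Binary.PropositionalEquality
  using (_≡_; _≢_; refl; sym; trans; cong; subst)
open import Function using (id)

take-++ : ∀ {A : Set} {m n} (xs : Vec A m) (ys : Vec A n) → take m (xs ++ ys) ≡ xs
take-++ []       ys = refl
take-++ (x ∷ xs) ys = cong (x ∷_) (take-++ xs ys)

∈-replicate⁻ : ∀ {A : Set} n {x y : A} → x ∈ replicate n y → x ≡ y
∈-replicate⁻ (suc n) (here x≡y) = x≡y
∈-replicate⁻ (suc n) (there x∈) = ∈-replicate⁻ n x∈

map≡just⁻ : ∀ {A B : Set} {f : A → B} {mx y} → Maybe.map f mx ≡ just y → ∃[ x ] (mx ≡ just x)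
map≡just⁻ {mx = just x}  _  = x , refl
map≡just⁻ {mx = nothing} ()

⊥Tuple : ∀ n → Vec Loc n
⊥Tuple n = replicate n ⊥L

truncCell : ∀ κ ν μ → Vec Loc (κ + ν + μ) → Vec Loc κ
truncCell κ ν μ v = take κ (take (κ + ν) v)

truncCell-++ : ∀ {κ ν μ} (a : Vec Loc κ) (l : Vec Loc ν) (b : Vec Loc μ) →
               truncCell κ ν μ ((a ++ l) ++ b) ≡ a
truncCell-++ a l b = trans (cong (take _) (take-++ (a ++ l) b)) (take-++ a l)

cell-with-store≢⊥ : ∀ {κ ν μ} {w : Vec Var ν} (s : Store w) → 0 < ν →
                    (a : Vec Loc κ) {l : Vec Loc ν} (b : Vec Loc μ) → StoreOf s l →
                    (a ++ l) ++ b ≢ ⊥Tuple (κ + ν + μ)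
cell-with-store≢⊥ {κ} {ν} {μ} s (s≤s z≤n) a b (sx≡ℓ ∷ _) cell≡⊥ =
  Store.val-≢⊥ s _ _ sx≡ℓ
    (∈-replicate⁻ (κ + ν + μ) (subst (_ ∈_) cell≡⊥ (∈-++⁺ˡ (∈-++⁺ʳ a (here refl)))))

module _ {κ ν μ} (h' : PMap (κ + ν + μ)) (ℓ : Loc) where

  trunc-undefined : h' ℓ ≡ nothing → trunc κ ν μ h' ℓ ≡ nothing
  trunc-undefined h'ℓ≡ rewrite h'ℓ≡ = refl

  trunc-⊥ : h' ℓ ≡ just (⊥Tuple (κ + ν + μ)) → trunc κ ν μ h' ℓ ≡ nothing
  trunc-⊥ h'ℓ≡ rewrite h'ℓ≡ with ≡-dec ℕ._≟_ (⊥Tuple (κ + ν + μ)) (⊥Tuple (κ + ν + μ))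
  ... | yes _ = refl
  ... | no ≢⊥ = contradiction refl ≢⊥

  trunc-defined : ∀ {v} → h' ℓ ≡ just v → v ≢ ⊥Tuple (κ + ν + μ) →
                  trunc κ ν μ h' ℓ ≡ just (truncCell κ ν μ v)
  trunc-defined {v} h'ℓ≡ v≢⊥ rewrite h'ℓ≡ with ≡-dec ℕ._≟_ v (⊥Tuple (κ + ν + μ))
  ... | yes v≡⊥ = contradiction v≡⊥ v≢⊥
  ... | no _    = refl

module _ {κ ν μ} {w : Vec Var ν} {s : Store w} {γ : Loc → Loc}
         {h' : PMap (κ + ν + μ)} {h : PMap κ}
         (ν>0 : 0 < ν) (E : Expansion κ ν μ w s γ h' h) where
  open Expansion E

  main-cell≢⊥ : ∀ {ℓ v} → main ℓ ≡ just v → v ≢ ⊥Tuple (κ + ν + μ)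
  main-cell≢⊥ {ℓ} {v} mainℓ≡ with main-shape ℓ v mainℓ≡
  ... | a , _ , b , refl , sl , _ = cell-with-store≢⊥ s ν>0 a b sl

  trunc≡truncated-main : ∀ ℓ → trunc κ ν μ h' ℓ ≡ Maybe.map (truncCell κ ν μ) (main ℓ)
  trunc≡truncated-main ℓ with main ℓ in mainℓ≡ | aux ℓ in auxℓ≡ | union ℓ
  ... | just v  | _       | h'ℓ≡ = trunc-defined h' ℓ h'ℓ≡ (main-cell≢⊥ mainℓ≡)
  ... | nothing | nothing | h'ℓ≡ = trunc-undefined h' ℓ h'ℓ≡
  ... | nothing | just v  | h'ℓ≡ with aux-shape ℓ v auxℓ≡
  ...   | refl , _ = trunc-⊥ h' ℓ h'ℓ≡

  dom-trunc⇒dom-main : ∀ {ℓ} → InDom (trunc κ ν μ h') ℓ → InDom main ℓ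
  dom-trunc⇒dom-main {ℓ} (a , truncℓ≡) =
    map≡just⁻ (trans (sym (trunc≡truncated-main ℓ)) truncℓ≡)

  dom-main⇒dom-trunc : ∀ {ℓ} → InDom main ℓ → InDom (trunc κ ν μ h') ℓ
  dom-main⇒dom-trunc {ℓ} (v , mainℓ≡) =
    truncCell κ ν μ v , trans (trunc≡truncated-main ℓ) (map-just mainℓ≡)

  trunc-at-main : ∀ {ℓ a l b} → main ℓ ≡ just ((a ++ l) ++ b) → trunc κ ν μ h' ℓ ≡ just a
  trunc-at-main {ℓ} {a} {l} {b} mainℓ≡ =
    trans (trunc≡truncated-main ℓ) (trans (map-just mainℓ≡) (cong just (truncCell-++ a l b)))

  h∘γ≡γ∘trunc : ∀ {ℓ} → InDom main ℓ → h (γ ℓ) ≡ Maybe.map (map γ) (trunc κ ν μ h' ℓ)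
  h∘γ≡γ∘trunc {ℓ} (v , mainℓ≡) with main-shape ℓ v mainℓ≡
  ... | _ , _ , _ , refl , _ , hγℓ≡ rewrite trunc-at-main mainℓ≡ = hγℓ≡

  expansion⇒image-trunc : Image γ (trunc κ ν μ h') h
  expansion⇒image-trunc = record
    { inj   = λ ℓ₁ ℓ₂ d₁ d₂ → inj ℓ₁ ℓ₂ (dom-trunc⇒dom-main d₁) (dom-trunc⇒dom-main d₂)
    ; onDom = λ ℓ d → h∘γ≡γ∘trunc (dom-trunc⇒dom-main d)
    ; dom⊆  = λ ℓ' d → let ℓ , dm , γℓ≡ℓ' = dom-from ℓ' d in ℓ , dom-main⇒dom-trunc dm , γℓ≡ℓ'
    }

  expansion⇒id-expansion-trunc : Expansion κ ν μ w s id h' (trunc κ ν μ h')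
  expansion⇒id-expansion-trunc = record
    { main       = main
    ; aux        = aux
    ; main-heap  = main-heap
    ; aux-heap   = aux-heap
    ; disjoint   = disjoint
    ; union      = union
    ; inj        = λ _ _ _ _ ℓ₁≡ℓ₂ → ℓ₁≡ℓ₂
    ; dom-to     = λ _ → dom-main⇒dom-trunc
    ; dom-from   = λ ℓ d → ℓ , dom-trunc⇒dom-main d , refl
    ; main-shape = main-shape-id
    ; aux-shape  = aux-shape
    }
    where
    main-shape-id : ∀ ℓ v → main ℓ ≡ just v →
                    ∃[ a ] ∃[ l ] ∃[ b ] (v ≡ (a ++ l) ++ b × StoreOf s l
                                          × trunc κ ν μ h' ℓ ≡ just (map id a))
    main-shape-id ℓ v mainℓ≡ with main-shape ℓ v mainℓ≡
    ... | a , l , b , refl , sl , _ =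
      a , l , b , refl , sl , trans (trunc-at-main mainℓ≡) (cong just (sym (map-id a)))

lemma3 : (κ ν μ : ℕ) (w : Vec Var ν) → 0 < ν →
         (γ : Loc → Loc) (s : Store w) (h : PMap κ) (h' : PMap (κ + ν + μ)) →
         IsHeap h → IsHeap h' →
         Expansion κ ν μ w s γ h' h →
         Image γ (trunc κ ν μ h') h × Expansion κ ν μ w s id h' (trunc κ ν μ h')
lemma3 κ ν μ w ν>0 γ s h h' _ _ E =
  expansion⇒image-trunc ν>0 E , expansion⇒id-expansion-trunc ν>0 E
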